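{- The species $\mathbb{V}$ of connected finite topological spaces, equipped with the grafting product $\searrow$, is a twisted (left) pre-Lie algebra: for all pairwise disjoint finite sets $X_1,X_2,X_3$ and all connected topologies $\mathcal{T}_i$ on $X_i$, $$\mathcal{T}_1\searrow(\mathcal{T}_2\searrow\mathcal{T}_3)-(\mathcal{T}_1\searrow\mathcal{T}_2)\searrow\mathcal{T}_3=\mathcal{T}_2\searrow(\mathcal{T}_1\searrow\mathcal{T}_3)-(\mathcal{T}_2\searrow\mathcal{T}_1)\searrow\mathcal{T}_3.$$
   Context: A finite topological space is a finite set with a preorder $\leq$ (open sets = upper sets); it is connected if it is connected as a topological space. A linear species is a contravariant functor from finite sets with bijections to vector spaces over a field $\mathbf{k}$; the species $\mathbb{V}$ assigns to a finite set $X$ the vector space $\mathbb{V}_X$ freely spanned by the connected topologies on $X$, with relabelling along bijections. For finite topological spaces $\mathcal{T}_1=(X_1,\leq_1)$, $\mathcal{T}_2=(X_2,\leq_2)$ on disjoint sets and $v\in X_2$, $\mathcal{T}_1\searrow_v\mathcal{T}_2=(X_1\sqcup X_2,\leq)$ where $x\leq y$ iff ($x,y\in X_1$, $x\leq_1 y$) or ($x,y\in X_2$, $x\leq_2y$) or ($x\in X_2$, $y\in X_1$, $x\leq_2 v$). The product $\searrow:\mathbb{V}_{X_1}\otimes\mathbb{V}_{X_2}\to\mathbb{V}_{X_1\sqcup X_2}$ is the bilinear map with $\mathcal{T}_1\searrow\mathcal{T}_2=\sum_{v\in X_2}\mathcal{T}_1\searrow_v\mathcal{T}_2$. A twisted pre-Lie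 algebra is a species with a species map $\circ:\mathbb{E}\otimes\mathbb{E}\to\mathbb{E}$ satisfying the displayed left pre-Lie identity on disjoint labels. -}

module Defs where

open import Level using (Level; _⊔_) renaming (suc to lsuc)
open import Data.Nat using (ℕ; _≡ᵇ_)
open import Data.Bool using (Bool; true; false; _∧_; _∨_; not; if_then_else_)
open import Data.List using (List; []; _∷_; _++_; map; concatMap; foldr)
open import Data.Bool.ListAction using (any; all)
open import Data.List.Membership.Propositional using (_∈_)
open import Data.List.Relation.Unary.Unique.Propositional using (Unique)
open import Data.Product using (_×_; _,_; Σ)
open import Data.Sum using (_⊎_)
open import Relation.Nullary using (¬_)
open import Relation.Binary.PropositionalEquality using (_≡_)
open import Algebra.Bundles using (CommutativeRing)

record Field (c ℓ : Level) : Set (lsuc (c ⊔ ℓ)) where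
  field
    commutativeRing : CommutativeRing c ℓ
  open CommutativeRing commutativeRing public
  field
    0≉1     : ¬ (0# ≈ 1#)
    inverse : ∀ x → ¬ (x ≈ 0#) → Σ Carrier (λ y → x * y ≈ 1#)

-- Labels are natural numbers; a finite set is a duplicate-free list of
-- labels.  A finite topological space is a finite set X together with a
-- (Boolean-valued) relation ≤, of which only the values on X matter.

_∈ᵇ_ : ℕ → List ℕ → Bool
x ∈ᵇ X = any (x ≡ᵇ_) X

record Space : Set where
  constructor mkSpace
  field
    carrier : List ℕ
    leq     : ℕ → ℕ → Bool
open Space public

IsPreorder : Space → Set
IsPreorder T =
  (∀ {x} → x ∈ carrier T → leq T x x ≡ true) ×
  (∀ {x y z} → x ∈ carrier T → y ∈ carrier T → z ∈ carrier T →
     leq T x y ≡ true → leq T y z ≡ true → leq T x z ≡ true)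

IsOpen : Space → (ℕ → Bool) → Set
IsOpen T U = ∀ {x y} → x ∈ carrier T → y ∈ carrier T →
  U x ≡ true → leq T x y ≡ true → U y ≡ true

IsConnected : Space → Set
IsConnected T =
  Σ ℕ (λ x → x ∈ carrier T) ×
  (∀ U → IsOpen T U → IsOpen T (λ x → not (U x)) →
     (∀ {x} → x ∈ carrier T → U x ≡ true) ⊎
     (∀ {x} → x ∈ carrier T → U x ≡ false))

IsConnectedTopology : Space → Set
IsConnectedTopology T = Unique (carrier T) × IsPreorder T × IsConnected T

Disjoint : List ℕ → List ℕ → Set
Disjoint X Y = ∀ {x} → x ∈ X → ¬ (x ∈ Y)

graftAt : Space → Space → ℕ → Space
graftAt T₁ T₂ v = mkSpace (carrier T₁ ++ carrier T₂) R
  where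
  R : ℕ → ℕ → Bool
  R x y =
    if (x ∈ᵇ carrier T₁) ∧ (y ∈ᵇ carrier T₁) then leq T₁ x y
    else if (x ∈ᵇ carrier T₂) ∧ (y ∈ᵇ carrier T₂) then leq T₂ x y
    else if (x ∈ᵇ carrier T₂) ∧ (y ∈ᵇ carrier T₁) then leq T₂ x v
    else false

-- Formal linear combinations of spaces with coefficients in a field,
-- the grafting product extended bilinearly, and equality in the free
-- vector space (equal coefficient of every basis element).

module Linear {c ℓ} (K : Field c ℓ) where
  open Field K

  LC : Set c
  LC = List (Carrier × Space)

  basis : Space → LC
  basis T = (1# , T) ∷ []

  neg : LC → LC
  neg = map (λ { (a , T) → (- a , T) })

  _⊖_ : LC → LC → LC
  A ⊖ B = A ++ neg B

  _↘_ : LC → LC → LC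
  A ↘ B = concatMap (λ { (a , T₁) →
            concatMap (λ { (b , T₂) →
              map (λ v → (a * b , graftAt T₁ T₂ v)) (carrier T₂) }) B }) A

  sameSpace : Space → Space → Bool
  sameSpace S T =
    all (_∈ᵇ carrier T) (carrier S) ∧ all (_∈ᵇ carrier S) (carrier T) ∧
    all (λ x → all (λ y → eqB (leq S x y) (leq T x y)) (carrier S)) (carrier S)
    where
    eqB : Bool → Bool → Bool
    eqB true  b = b
    eqB false b = not b

  coeff : Space → LC → Carrier
  coeff S = foldr (λ { (a , T) r → (if sameSpace S T then a else 0#) + r }) 0#

  _≋_ : LC → LC → Set ℓ
  A ≋ B = ∀ S → coeff S A ≈ coeff S B

-- Expanding the products, the coefficient of a space S in T₁ ↘ (T₂ ↘ T₃) counts the pairs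
-- w ∈ X₃, v ∈ X₂ ⊔ X₃ with S = T₁ ↘_v (T₂ ↘_w T₃). For v ∈ X₂ that space is
-- (T₁ ↘_v T₂) ↘_w T₃, and these pairs account exactly for (T₁ ↘ T₂) ↘ T₃. So the
-- associator counts the pairs v, w ∈ X₃, where T₁ and T₂ are grafted independently
-- onto T₃ at v and at w, which is symmetric in T₁ and T₂.
module Submission where

open import Defs
open import Level using (Level)
open import Algebra.Bundles using (CommutativeMonoid)
open import Data.Bool using (true; false; T; if_then_else_)
open import Data.Bool.ListAction using (all)
open import Data.Bool.Properties using (T?; T-≡; T-∧; ¬-not; ⇔→≡)
open import Data.Empty using (⊥-elim)
open import Data.Nat using (ℕ; _≡ᵇ_)
open import Data.Nat.Properties using (≡ᵇ⇒≡; ≡⇒≡ᵇ)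
open import Data.List using (List; []; _∷_; _++_; map; concatMap)
open import Data.List.Properties using (++-assoc)
open import Data.List.Membership.Propositional using (_∈_; _∉_; find)
open import Data.List.Membership.Propositional.Properties using (∈-++⁺ˡ; ∈-++⁺ʳ; ∈-++⁻)
open import Data.List.Relation.Binary.Permutation.Propositional.Properties using (∈-resp-↭; shifts)
open import Data.List.Relation.Binary.Subset.Propositional using (_⊆_)
open import Data.List.Relation.Unary.All using (lookup; tabulate)
open import Data.List.Relation.Unary.All.Properties using (all⁺; all⁻; ¬All⇒Any¬)
import Data.List.Relation.Unary.Any as Any
open Any using (here; there)
open import Data.List.Relation.Unary.Any.Properties using (any⁺; any⁻)
open import Data.Product using (_×_; _,_; proj₁; proj₂)
open import Data.Sum using (_⊎_; inj₁; inj₂)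
open import Function using (_∘_; mk⇔; Equivalence)
open import Relation.Nullary using (yes; no)
import Relation.Binary.PropositionalEquality as ≡
open ≡ using (_≡_)

∈ᵇ⇒∈ : ∀ {x} xs → T (x ∈ᵇ xs) → x ∈ xs
∈ᵇ⇒∈ {x} xs p = Any.map (≡ᵇ⇒≡ x _) (any⁻ (x ≡ᵇ_) xs p)

∈⇒∈ᵇ : ∀ {x xs} → x ∈ xs → T (x ∈ᵇ xs)
∈⇒∈ᵇ {x} p = any⁺ (x ≡ᵇ_) (Any.map (≡⇒≡ᵇ x _) p)

∈⇒∈ᵇ≡true : ∀ {x xs} → x ∈ xs → x ∈ᵇ xs ≡ true
∈⇒∈ᵇ≡true p = Equivalence.to T-≡ (∈⇒∈ᵇ p)

∉⇒∈ᵇ≡false : ∀ {x xs} → x ∉ xs → x ∈ᵇ xs ≡ false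
∉⇒∈ᵇ≡false {xs = xs} x∉xs = ¬-not (λ e → x∉xs (∈ᵇ⇒∈ xs (Equivalence.from T-≡ e)))

⊆ᵇ⇒⊆ : ∀ X {Y} → T (all (_∈ᵇ Y) X) → X ⊆ Y
⊆ᵇ⇒⊆ X X⊆ᵇY = ∈ᵇ⇒∈ _ ∘ lookup (all⁺ _ X X⊆ᵇY)

⊆⇒⊆ᵇ : ∀ {X Y} → X ⊆ Y → T (all (_∈ᵇ Y) X)
⊆⇒⊆ᵇ X⊆Y = all⁻ _ (tabulate (∈⇒∈ᵇ ∘ X⊆Y))

Disjoint-sym : ∀ {X Y} → Disjoint X Y → Disjoint Y X
Disjoint-sym X#Y y∈Y y∈X = X#Y y∈X y∈Y

Disjoint-++ˡ : ∀ {X Y Z} → Disjoint X Z → Disjoint Y Z → Disjoint (X ++ Y) Z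
Disjoint-++ˡ {X} X#Z Y#Z x∈X++Y with ∈-++⁻ X x∈X++Y
... | inj₁ x∈X = X#Z x∈X
... | inj₂ x∈Y = Y#Z x∈Y

Disjoint-++ʳ : ∀ {X Y Z} → Disjoint X Y → Disjoint X Z → Disjoint X (Y ++ Z)
Disjoint-++ʳ X#Y X#Z = Disjoint-sym (Disjoint-++ˡ (Disjoint-sym X#Y) (Disjoint-sym X#Z))

∈-++-++⁻ : ∀ (X Y : List ℕ) {Z x} → x ∈ X ++ (Y ++ Z) → x ∈ X ⊎ x ∈ Y ⊎ x ∈ Z
∈-++-++⁻ X Y x∈ with ∈-++⁻ X x∈
... | inj₁ x∈X = inj₁ x∈X
... | inj₂ x∈Y++Z = inj₂ (∈-++⁻ Y x∈Y++Z)

module _ (T U : Space) (v : ℕ) {x y : ℕ} where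

  graftAt-leq₁₁ : x ∈ carrier T → y ∈ carrier T → leq (graftAt T U v) x y ≡ leq T x y
  graftAt-leq₁₁ x∈T y∈T rewrite ∈⇒∈ᵇ≡true x∈T | ∈⇒∈ᵇ≡true y∈T = ≡.refl

  module _ (T#U : Disjoint (carrier T) (carrier U)) where

    graftAt-leq₂₂ : x ∈ carrier U → y ∈ carrier U → leq (graftAt T U v) x y ≡ leq U x y
    graftAt-leq₂₂ x∈U y∈U
      rewrite ∉⇒∈ᵇ≡false (λ x∈T → T#U x∈T x∈U) | ∈⇒∈ᵇ≡true x∈U | ∈⇒∈ᵇ≡true y∈U = ≡.refl

    graftAt-leq₂₁ : x ∈ carrier U → y ∈ carrier T → leq (graftAt T U v) x y ≡ leq U x v
    graftAt-leq₂₁ x∈U y∈T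
      rewrite ∉⇒∈ᵇ≡false (λ x∈T → T#U x∈T x∈U) | ∉⇒∈ᵇ≡false (T#U y∈T)
            | ∈⇒∈ᵇ≡true x∈U | ∈⇒∈ᵇ≡true y∈T = ≡.refl

    graftAt-leq₁₂ : x ∈ carrier T → y ∈ carrier U → leq (graftAt T U v) x y ≡ false
    graftAt-leq₁₂ x∈T y∈U
      rewrite ∉⇒∈ᵇ≡false (λ y∈T → T#U y∈T y∈U) | ∉⇒∈ᵇ≡false (T#U x∈T) | ∈⇒∈ᵇ≡true x∈T = ≡.refl

record _≃_ (S U : Space) : Set where
  field
    carrier-⊆ : carrier S ⊆ carrier U
    carrier-⊇ : carrier U ⊆ carrier S
    leq-agrees : ∀ {x y} → x ∈ carrier S → y ∈ carrier S → leq S x y ≡ leq U x y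
open _≃_

≃-sym : ∀ {S U} → S ≃ U → U ≃ S
≃-sym S≃U = record
  { carrier-⊆ = carrier-⊇ S≃U
  ; carrier-⊇ = carrier-⊆ S≃U
  ; leq-agrees = λ x∈ y∈ → ≡.sym (leq-agrees S≃U (carrier-⊇ S≃U x∈) (carrier-⊇ S≃U y∈))
  }

≃-trans : ∀ {S U W} → S ≃ U → U ≃ W → S ≃ W
≃-trans S≃U U≃W = record
  { carrier-⊆ = λ x∈ → carrier-⊆ U≃W (carrier-⊆ S≃U x∈)
  ; carrier-⊇ = λ x∈ → carrier-⊇ S≃U (carrier-⊇ U≃W x∈)
  ; leq-agrees = λ x∈ y∈ → ≡.trans (leq-agrees S≃U x∈ y∈)
      (leq-agrees U≃W (carrier-⊆ S≃U x∈) (carrier-⊆ S≃U y∈))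
  }

module _ {T₁ T₂ T₃ : Space}
  (X₁#X₂ : Disjoint (carrier T₁) (carrier T₂)) (X₁#X₃ : Disjoint (carrier T₁) (carrier T₃))
  (X₂#X₃ : Disjoint (carrier T₂) (carrier T₃)) where

  open ≡ using (sym; trans)

  private
    X₁ X₂ X₃ : List ℕ
    X₁ = carrier T₁
    X₂ = carrier T₂
    X₃ = carrier T₃

    X₁#X₂₃ : Disjoint X₁ (X₂ ++ X₃)
    X₁#X₂₃ = Disjoint-++ʳ X₁#X₂ X₁#X₃

  graftAt-assoc : ∀ {v} w → v ∈ X₂ →
    graftAt T₁ (graftAt T₂ T₃ w) v ≃ graftAt (graftAt T₁ T₂ v) T₃ w
  graftAt-assoc {v} w v∈X₂ = record
    { carrier-⊆ = ≡.subst (_ ∈_) (≡.sym (++-assoc X₁ X₂ X₃))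
    ; carrier-⊇ = ≡.subst (_ ∈_) (++-assoc X₁ X₂ X₃)
    ; leq-agrees = λ x∈ y∈ → agree (∈-++-++⁻ X₁ X₂ x∈) (∈-++-++⁻ X₁ X₂ y∈)
    }
    where
    X₁₂#X₃ : Disjoint (X₁ ++ X₂) X₃
    X₁₂#X₃ = Disjoint-++ˡ X₁#X₃ X₂#X₃
    U V : Space
    U = graftAt T₂ T₃ w
    V = graftAt T₁ T₂ v
    agree : ∀ {x y} → x ∈ X₁ ⊎ x ∈ X₂ ⊎ x ∈ X₃ → y ∈ X₁ ⊎ y ∈ X₂ ⊎ y ∈ X₃ →
      leq (graftAt T₁ U v) x y ≡ leq (graftAt V T₃ w) x y
    agree (inj₁ x∈₁) (inj₁ y∈₁) = trans
      (graftAt-leq₁₁ T₁ U v x∈₁ y∈₁)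
      (sym (trans (graftAt-leq₁₁ V T₃ w (∈-++⁺ˡ x∈₁) (∈-++⁺ˡ y∈₁)) (graftAt-leq₁₁ T₁ T₂ v x∈₁ y∈₁)))
    agree (inj₁ x∈₁) (inj₂ (inj₁ y∈₂)) = trans
      (graftAt-leq₁₂ T₁ U v X₁#X₂₃ x∈₁ (∈-++⁺ˡ y∈₂))
      (sym (trans (graftAt-leq₁₁ V T₃ w (∈-++⁺ˡ x∈₁) (∈-++⁺ʳ X₁ y∈₂)) (graftAt-leq₁₂ T₁ T₂ v X₁#X₂ x∈₁ y∈₂)))
    agree (inj₁ x∈₁) (inj₂ (inj₂ y∈₃)) = trans
      (graftAt-leq₁₂ T₁ U v X₁#X₂₃ x∈₁ (∈-++⁺ʳ X₂ y∈₃))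
      (sym (graftAt-leq₁₂ V T₃ w X₁₂#X₃ (∈-++⁺ˡ x∈₁) y∈₃))
    agree (inj₂ (inj₁ x∈₂)) (inj₁ y∈₁) = trans
      (trans (graftAt-leq₂₁ T₁ U v X₁#X₂₃ (∈-++⁺ˡ x∈₂) y∈₁) (graftAt-leq₁₁ T₂ T₃ w x∈₂ v∈X₂))
      (sym (trans (graftAt-leq₁₁ V T₃ w (∈-++⁺ʳ X₁ x∈₂) (∈-++⁺ˡ y∈₁)) (graftAt-leq₂₁ T₁ T₂ v X₁#X₂ x∈₂ y∈₁)))
    agree (inj₂ (inj₁ x∈₂)) (inj₂ (inj₁ y∈₂)) = trans
      (trans (graftAt-leq₂₂ T₁ U v X₁#X₂₃ (∈-++⁺ˡ x∈₂) (∈-++⁺ˡ y∈₂)) (graftAt-leq₁₁ T₂ T₃ w x∈₂ y∈₂))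
      (sym (trans (graftAt-leq₁₁ V T₃ w (∈-++⁺ʳ X₁ x∈₂) (∈-++⁺ʳ X₁ y∈₂)) (graftAt-leq₂₂ T₁ T₂ v X₁#X₂ x∈₂ y∈₂)))
    agree (inj₂ (inj₁ x∈₂)) (inj₂ (inj₂ y∈₃)) = trans
      (trans (graftAt-leq₂₂ T₁ U v X₁#X₂₃ (∈-++⁺ˡ x∈₂) (∈-++⁺ʳ X₂ y∈₃)) (graftAt-leq₁₂ T₂ T₃ w X₂#X₃ x∈₂ y∈₃))
      (sym (graftAt-leq₁₂ V T₃ w X₁₂#X₃ (∈-++⁺ʳ X₁ x∈₂) y∈₃))
    agree (inj₂ (inj₂ x∈₃)) (inj₁ y∈₁) = trans
      (trans (graftAt-leq₂₁ T₁ U v X₁#X₂₃ (∈-++⁺ʳ X₂ x∈₃) y∈₁) (graftAt-leq₂₁ T₂ T₃ w X₂#X₃ x∈₃ v∈X₂))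
      (sym (graftAt-leq₂₁ V T₃ w X₁₂#X₃ x∈₃ (∈-++⁺ˡ y∈₁)))
    agree (inj₂ (inj₂ x∈₃)) (inj₂ (inj₁ y∈₂)) = trans
      (trans (graftAt-leq₂₂ T₁ U v X₁#X₂₃ (∈-++⁺ʳ X₂ x∈₃) (∈-++⁺ˡ y∈₂)) (graftAt-leq₂₁ T₂ T₃ w X₂#X₃ x∈₃ y∈₂))
      (sym (graftAt-leq₂₁ V T₃ w X₁₂#X₃ x∈₃ (∈-++⁺ʳ X₁ y∈₂)))
    agree (inj₂ (inj₂ x∈₃)) (inj₂ (inj₂ y∈₃)) = trans
      (trans (graftAt-leq₂₂ T₁ U v X₁#X₂₃ (∈-++⁺ʳ X₂ x∈₃) (∈-++⁺ʳ X₂ y∈₃)) (graftAt-leq₂₂ T₂ T₃ w X₂#X₃ x∈₃ y∈₃))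
      (sym (graftAt-leq₂₂ V T₃ w X₁₂#X₃ x∈₃ y∈₃))

  graftAt-exchange : ∀ {v w} → v ∈ X₃ → w ∈ X₃ →
    graftAt T₁ (graftAt T₂ T₃ w) v ≃ graftAt T₂ (graftAt T₁ T₃ v) w
  graftAt-exchange {v} {w} v∈X₃ w∈X₃ = record
    { carrier-⊆ = ∈-resp-↭ (shifts X₁ X₂)
    ; carrier-⊇ = ∈-resp-↭ (shifts X₂ X₁)
    ; leq-agrees = λ x∈ y∈ → agree (∈-++-++⁻ X₁ X₂ x∈) (∈-++-++⁻ X₁ X₂ y∈)
    }
    where
    X₂#X₁₃ : Disjoint X₂ (X₁ ++ X₃)
    X₂#X₁₃ = Disjoint-++ʳ (Disjoint-sym X₁#X₂) X₂#X₃
    U W : Space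
    U = graftAt T₂ T₃ w
    W = graftAt T₁ T₃ v
    agree : ∀ {x y} → x ∈ X₁ ⊎ x ∈ X₂ ⊎ x ∈ X₃ → y ∈ X₁ ⊎ y ∈ X₂ ⊎ y ∈ X₃ →
      leq (graftAt T₁ U v) x y ≡ leq (graftAt T₂ W w) x y
    agree (inj₁ x∈₁) (inj₁ y∈₁) = trans
      (graftAt-leq₁₁ T₁ U v x∈₁ y∈₁)
      (sym (trans (graftAt-leq₂₂ T₂ W w X₂#X₁₃ (∈-++⁺ˡ x∈₁) (∈-++⁺ˡ y∈₁)) (graftAt-leq₁₁ T₁ T₃ v x∈₁ y∈₁)))
    agree (inj₁ x∈₁) (inj₂ (inj₁ y∈₂)) = trans
      (graftAt-leq₁₂ T₁ U v X₁#X₂₃ x∈₁ (∈-++⁺ˡ y∈₂))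
      (sym (trans (graftAt-leq₂₁ T₂ W w X₂#X₁₃ (∈-++⁺ˡ x∈₁) y∈₂) (graftAt-leq₁₂ T₁ T₃ v X₁#X₃ x∈₁ w∈X₃)))
    agree (inj₁ x∈₁) (inj₂ (inj₂ y∈₃)) = trans
      (graftAt-leq₁₂ T₁ U v X₁#X₂₃ x∈₁ (∈-++⁺ʳ X₂ y∈₃))
      (sym (trans (graftAt-leq₂₂ T₂ W w X₂#X₁₃ (∈-++⁺ˡ x∈₁) (∈-++⁺ʳ X₁ y∈₃)) (graftAt-leq₁₂ T₁ T₃ v X₁#X₃ x∈₁ y∈₃)))
    agree (inj₂ (inj₁ x∈₂)) (inj₁ y∈₁) = trans
      (trans (graftAt-leq₂₁ T₁ U v X₁#X₂₃ (∈-++⁺ˡ x∈₂) y∈₁) (graftAt-leq₁₂ T₂ T₃ w X₂#X₃ x∈₂ v∈X₃))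
      (sym (graftAt-leq₁₂ T₂ W w X₂#X₁₃ x∈₂ (∈-++⁺ˡ y∈₁)))
    agree (inj₂ (inj₁ x∈₂)) (inj₂ (inj₁ y∈₂)) = trans
      (trans (graftAt-leq₂₂ T₁ U v X₁#X₂₃ (∈-++⁺ˡ x∈₂) (∈-++⁺ˡ y∈₂)) (graftAt-leq₁₁ T₂ T₃ w x∈₂ y∈₂))
      (sym (graftAt-leq₁₁ T₂ W w x∈₂ y∈₂))
    agree (inj₂ (inj₁ x∈₂)) (inj₂ (inj₂ y∈₃)) = trans
      (trans (graftAt-leq₂₂ T₁ U v X₁#X₂₃ (∈-++⁺ˡ x∈₂) (∈-++⁺ʳ X₂ y∈₃)) (graftAt-leq₁₂ T₂ T₃ w X₂#X₃ x∈₂ y∈₃))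
      (sym (graftAt-leq₁₂ T₂ W w X₂#X₁₃ x∈₂ (∈-++⁺ʳ X₁ y∈₃)))
    agree (inj₂ (inj₂ x∈₃)) (inj₁ y∈₁) = trans
      (trans (graftAt-leq₂₁ T₁ U v X₁#X₂₃ (∈-++⁺ʳ X₂ x∈₃) y∈₁) (graftAt-leq₂₂ T₂ T₃ w X₂#X₃ x∈₃ v∈X₃))
      (sym (trans (graftAt-leq₂₂ T₂ W w X₂#X₁₃ (∈-++⁺ʳ X₁ x∈₃) (∈-++⁺ˡ y∈₁)) (graftAt-leq₂₁ T₁ T₃ v X₁#X₃ x∈₃ y∈₁)))
    agree (inj₂ (inj₂ x∈₃)) (inj₂ (inj₁ y∈₂)) = trans
      (trans (graftAt-leq₂₂ T₁ U v X₁#X₂₃ (∈-++⁺ʳ X₂ x∈₃) (∈-++⁺ˡ y∈₂)) (graftAt-leq₂₁ T₂ T₃ w X₂#X₃ x∈₃ y∈₂))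
      (sym (trans (graftAt-leq₂₁ T₂ W w X₂#X₁₃ (∈-++⁺ʳ X₁ x∈₃) y∈₂) (graftAt-leq₂₂ T₁ T₃ v X₁#X₃ x∈₃ w∈X₃)))
    agree (inj₂ (inj₂ x∈₃)) (inj₂ (inj₂ y∈₃)) = trans
      (trans (graftAt-leq₂₂ T₁ U v X₁#X₂₃ (∈-++⁺ʳ X₂ x∈₃) (∈-++⁺ʳ X₂ y∈₃)) (graftAt-leq₂₂ T₂ T₃ w X₂#X₃ x∈₃ y∈₃))
      (sym (trans (graftAt-leq₂₂ T₂ W w X₂#X₁₃ (∈-++⁺ʳ X₁ x∈₃) (∈-++⁺ʳ X₁ y∈₃)) (graftAt-leq₂₂ T₁ T₃ v X₁#X₃ x∈₃ y∈₃)))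

module ListSum {c ℓ} (M : CommutativeMonoid c ℓ) where
  open CommutativeMonoid M
  open import Algebra.Properties.CommutativeSemigroup commutativeSemigroup using (interchange)

  private
    variable
      a b : Level
      A : Set a
      B : Set b

  ∑ : List A → (A → Carrier) → Carrier
  ∑ []       f = ε
  ∑ (x ∷ xs) f = f x ∙ ∑ xs f

  syntax ∑ xs (λ x → e) = ∑[ x ∈ xs ] e

  ∑-++ : ∀ (xs ys : List A) f → ∑ (xs ++ ys) f ≈ ∑ xs f ∙ ∑ ys f
  ∑-++ []       ys f = sym (identityˡ _)
  ∑-++ (x ∷ xs) ys f = trans (∙-congˡ (∑-++ xs ys f)) (sym (assoc _ _ _))

  ∑-cong : ∀ (xs : List A) {f g} → (∀ {x} → x ∈ xs → f x ≈ g x) → ∑ xs f ≈ ∑ xs g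
  ∑-cong []       f≈g = refl
  ∑-cong (x ∷ xs) f≈g = ∙-cong (f≈g (here ≡.refl)) (∑-cong xs (f≈g ∘ there))

  ∑-map : ∀ (g : A → B) xs f → ∑ (map g xs) f ≡ ∑[ x ∈ xs ] f (g x)
  ∑-map g []       f = ≡.refl
  ∑-map g (x ∷ xs) f = ≡.cong (f (g x) ∙_) (∑-map g xs f)

  ∑-concatMap : ∀ (g : A → List B) xs f → ∑ (concatMap g xs) f ≈ ∑[ x ∈ xs ] ∑ (g x) f
  ∑-concatMap g []       f = refl
  ∑-concatMap g (x ∷ xs) f = trans (∑-++ (g x) (concatMap g xs) f) (∙-congˡ (∑-concatMap g xs f))

  ∑-ε : ∀ (xs : List A) → ∑[ x ∈ xs ] ε ≈ ε
  ∑-ε []       = refl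
  ∑-ε (x ∷ xs) = trans (identityˡ _) (∑-ε xs)

  ∑-distrib-∙ : ∀ (xs : List A) f g → ∑[ x ∈ xs ] (f x ∙ g x) ≈ ∑ xs f ∙ ∑ xs g
  ∑-distrib-∙ []       f g = sym (identityʳ ε)
  ∑-distrib-∙ (x ∷ xs) f g = trans (∙-congˡ (∑-distrib-∙ xs f g)) (interchange _ _ _ _)

  ∑-comm : ∀ (xs : List A) (ys : List B) (f : A → B → Carrier) →
    ∑[ x ∈ xs ] ∑[ y ∈ ys ] f x y ≈ ∑[ y ∈ ys ] ∑[ x ∈ xs ] f x y
  ∑-comm []       ys f = sym (∑-ε ys)
  ∑-comm (x ∷ xs) ys f = trans (∙-congˡ (∑-comm xs ys f)) (sym (∑-distrib-∙ ys (f x) _))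

module Coefficients {c ℓ} (K : Field c ℓ) where
  open Field K
  open Linear K
  open ListSum +-commutativeMonoid
  open import Algebra.Properties.Ring ring using (-0#≈0#; -‿+-comm)
  open import Algebra.Properties.AbelianGroup +-abelianGroup using (xyx⁻¹≈y)
  open import Relation.Binary.Reasoning.Setoid setoid

  -- sameSpace compares the relations with a Boolean equality local to its definition,
  -- which cannot be named: it is only evaluated under with-abstraction, and the
  -- converse direction finds a pair x, y on which it fails.
  sameSpace⇒leq-agrees : ∀ S U → T (sameSpace S U) →
    ∀ {x y} → x ∈ carrier S → y ∈ carrier S → leq S x y ≡ leq U x y
  sameSpace⇒leq-agrees S U same {x} {y} x∈S y∈S
    with lookup (all⁺ _ (carrier S) (lookup (all⁺ _ (carrier S)
           (proj₂ (Equivalence.to (T-∧ {all (_∈ᵇ carrier S) (carrier U)})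
             (proj₂ (Equivalence.to (T-∧ {all (_∈ᵇ carrier U) (carrier S)}) same))))) x∈S)) y∈S
  ... | xy-agree with leq S x y | leq U x y
  ...   | true  | true  = ≡.refl
  ...   | false | false = ≡.refl
  ...   | true  | false = ⊥-elim xy-agree
  ...   | false | true  = ⊥-elim xy-agree

  sameSpace⇒≃ : ∀ S U → T (sameSpace S U) → S ≃ U
  sameSpace⇒≃ S U same = record
    { carrier-⊆ = ⊆ᵇ⇒⊆ (carrier S) (proj₁ (Equivalence.to T-∧ same))
    ; carrier-⊇ = ⊆ᵇ⇒⊆ (carrier U) (proj₁ (Equivalence.to T-∧
        (proj₂ (Equivalence.to (T-∧ {all (_∈ᵇ carrier U) (carrier S)}) same))))
    ; leq-agrees = sameSpace⇒leq-agrees S U same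
    }

  ≃⇒sameSpace : ∀ S U → S ≃ U → T (sameSpace S U)
  ≃⇒sameSpace S U S≃U with T? (sameSpace S U)
  ... | yes same = same
  ... | no ¬same with find (¬All⇒Any¬ (T? ∘ _) (carrier S) (λ agree → ¬same
        (Equivalence.from (T-∧ {all (_∈ᵇ carrier U) (carrier S)}) (⊆⇒⊆ᵇ (carrier-⊆ S≃U) ,
         Equivalence.from (T-∧ {all (_∈ᵇ carrier S) (carrier U)}) (⊆⇒⊆ᵇ (carrier-⊇ S≃U) , all⁻ _ agree)))))
  ... | x , x∈S , ¬agreeₓ with find (¬All⇒Any¬ (T? ∘ _) (carrier S) (¬agreeₓ ∘ all⁻ _))
  ... | y , y∈S , ¬agreeₓᵧ with leq S x y | leq U x y | leq-agrees S≃U x∈S y∈S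
  ...   | true  | true  | _ = ⊥-elim (¬agreeₓᵧ _)
  ...   | false | false | _ = ⊥-elim (¬agreeₓᵧ _)

  sameSpace-resp-≃ : ∀ S {U U′} → U ≃ U′ → sameSpace S U ≡ sameSpace S U′
  sameSpace-resp-≃ S U≃U′ = ⇔→≡ (mk⇔ (transport U≃U′) (transport (≃-sym U≃U′)))
    where
    transport : ∀ {W W′} → W ≃ W′ → sameSpace S W ≡ true → sameSpace S W′ ≡ true
    transport {W} {W′} W≃W′ same = Equivalence.to T-≡
      (≃⇒sameSpace S W′ (≃-trans (sameSpace⇒≃ S W (Equivalence.from T-≡ same)) W≃W′))

  δ : Space → Space → Carrier
  δ S U = if sameSpace S U then 1# else 0#

  δ-resp-≃ : ∀ S {U U′} → U ≃ U′ → δ S U ≡ δ S U′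
  δ-resp-≃ S U≃U′ = ≡.cong (if_then 1# else 0#) (sameSpace-resp-≃ S U≃U′)

  termCoeff : Space → Carrier × Space → Carrier
  termCoeff S (a , U) = if sameSpace S U then a else 0#

  termCoeff-δ : ∀ S {a} U → a ≈ 1# → termCoeff S (a , U) ≈ δ S U
  termCoeff-δ S U a≈1 with sameSpace S U
  ... | true  = a≈1
  ... | false = refl

  coeff≡∑ : ∀ S A → coeff S A ≡ ∑ A (termCoeff S)
  coeff≡∑ S []      = ≡.refl
  coeff≡∑ S (t ∷ A) = ≡.cong (termCoeff S t +_) (coeff≡∑ S A)

  coeff-++ : ∀ S A B → coeff S (A ++ B) ≈ coeff S A + coeff S B
  coeff-++ S []      B = sym (+-identityˡ _)
  coeff-++ S (t ∷ A) B = trans (+-congˡ (coeff-++ S A B)) (sym (+-assoc _ _ _))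

  coeff-neg : ∀ S A → coeff S (neg A) ≈ - coeff S A
  coeff-neg S []            = sym -0#≈0#
  coeff-neg S ((a , U) ∷ A) = trans (+-cong (termCoeff-neg (sameSpace S U)) (coeff-neg S A)) (-‿+-comm _ _)
    where
    termCoeff-neg : ∀ b → (if b then - a else 0#) ≈ - (if b then a else 0#)
    termCoeff-neg true  = refl
    termCoeff-neg false = sym -0#≈0#

  coeff-⊖ : ∀ S A B → coeff S (A ⊖ B) ≈ coeff S A - coeff S B
  coeff-⊖ S A B = trans (coeff-++ S A (neg B)) (+-congˡ (coeff-neg S B))

  ∑-↘ : ∀ A B (f : Carrier × Space → Carrier) → ∑ (A ↘ B) f ≈
    ∑[ p ∈ A ] ∑[ q ∈ B ] ∑[ v ∈ carrier (proj₂ q) ] f (proj₁ p * proj₁ q , graftAt (proj₂ p) (proj₂ q) v)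
  ∑-↘ A B f = trans (∑-concatMap _ A f) (∑-cong A (λ _ →
    trans (∑-concatMap _ B f) (∑-cong B (λ {q} _ → reflexive (∑-map _ (carrier (proj₂ q)) f)))))

  ∑-basis↘ : ∀ S B (f : Carrier × Space → Carrier) → ∑ (basis S ↘ B) f ≈
    ∑[ q ∈ B ] ∑[ v ∈ carrier (proj₂ q) ] f (1# * proj₁ q , graftAt S (proj₂ q) v)
  ∑-basis↘ S B f = trans (∑-↘ (basis S) B f) (+-identityʳ _)

  ∑-↘basis : ∀ A U (f : Carrier × Space → Carrier) → ∑ (A ↘ basis U) f ≈
    ∑[ p ∈ A ] ∑[ w ∈ carrier U ] f (proj₁ p * 1# , graftAt (proj₂ p) U w)
  ∑-↘basis A U f = trans (∑-↘ A (basis U) f) (∑-cong A (λ _ → +-identityʳ _))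

  ∑-basis↘basis : ∀ S U (f : Carrier × Space → Carrier) → ∑ (basis S ↘ basis U) f ≈
    ∑[ v ∈ carrier U ] f (1# * 1# , graftAt S U v)
  ∑-basis↘basis S U f = trans (∑-basis↘ S (basis U) f) (+-identityʳ _)

  coeff-basis↘[basis↘basis] : ∀ T₁ T₂ T₃ S → coeff S (basis T₁ ↘ (basis T₂ ↘ basis T₃)) ≈
    ∑[ w ∈ carrier T₃ ] ∑[ v ∈ carrier T₂ ++ carrier T₃ ] δ S (graftAt T₁ (graftAt T₂ T₃ w) v)
  coeff-basis↘[basis↘basis] T₁ T₂ T₃ S = begin
    coeff S (basis T₁ ↘ (basis T₂ ↘ basis T₃))
      ≡⟨ coeff≡∑ S (basis T₁ ↘ (basis T₂ ↘ basis T₃)) ⟩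
    ∑ (basis T₁ ↘ (basis T₂ ↘ basis T₃)) (termCoeff S)
      ≈⟨ ∑-basis↘ T₁ (basis T₂ ↘ basis T₃) (termCoeff S) ⟩
    ∑[ q ∈ basis T₂ ↘ basis T₃ ] ∑[ v ∈ carrier (proj₂ q) ] termCoeff S (1# * proj₁ q , graftAt T₁ (proj₂ q) v)
      ≈⟨ ∑-basis↘basis T₂ T₃ _ ⟩
    ∑[ w ∈ carrier T₃ ] ∑[ v ∈ carrier T₂ ++ carrier T₃ ]
      termCoeff S (1# * (1# * 1#) , graftAt T₁ (graftAt T₂ T₃ w) v)
      ≈⟨ ∑-cong (carrier T₃) (λ {w} _ → ∑-cong (carrier T₂ ++ carrier T₃) (λ {v} _ →
           termCoeff-δ S (graftAt T₁ (graftAt T₂ T₃ w) v) (trans (*-identityˡ _) (*-identityˡ _)))) ⟩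
    ∑[ w ∈ carrier T₃ ] ∑[ v ∈ carrier T₂ ++ carrier T₃ ] δ S (graftAt T₁ (graftAt T₂ T₃ w) v) ∎

  coeff-[basis↘basis]↘basis : ∀ T₁ T₂ T₃ S → coeff S ((basis T₁ ↘ basis T₂) ↘ basis T₃) ≈
    ∑[ v ∈ carrier T₂ ] ∑[ w ∈ carrier T₃ ] δ S (graftAt (graftAt T₁ T₂ v) T₃ w)
  coeff-[basis↘basis]↘basis T₁ T₂ T₃ S = begin
    coeff S ((basis T₁ ↘ basis T₂) ↘ basis T₃)
      ≡⟨ coeff≡∑ S ((basis T₁ ↘ basis T₂) ↘ basis T₃) ⟩
    ∑ ((basis T₁ ↘ basis T₂) ↘ basis T₃) (termCoeff S)
      ≈⟨ ∑-↘basis (basis T₁ ↘ basis T₂) T₃ (termCoeff S) ⟩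
    ∑[ p ∈ basis T₁ ↘ basis T₂ ] ∑[ w ∈ carrier T₃ ] termCoeff S (proj₁ p * 1# , graftAt (proj₂ p) T₃ w)
      ≈⟨ ∑-basis↘basis T₁ T₂ _ ⟩
    ∑[ v ∈ carrier T₂ ] ∑[ w ∈ carrier T₃ ] termCoeff S ((1# * 1#) * 1# , graftAt (graftAt T₁ T₂ v) T₃ w)
      ≈⟨ ∑-cong (carrier T₂) (λ {v} _ → ∑-cong (carrier T₃) (λ {w} _ →
           termCoeff-δ S (graftAt (graftAt T₁ T₂ v) T₃ w) (trans (*-identityʳ _) (*-identityˡ _)))) ⟩
    ∑[ v ∈ carrier T₂ ] ∑[ w ∈ carrier T₃ ] δ S (graftAt (graftAt T₁ T₂ v) T₃ w) ∎

  associator : Space → Space → Space → LC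
  associator T₁ T₂ T₃ = (basis T₁ ↘ (basis T₂ ↘ basis T₃)) ⊖ ((basis T₁ ↘ basis T₂) ↘ basis T₃)

  module _ {T₁ T₂ T₃ : Space}
    (X₁#X₂ : Disjoint (carrier T₁) (carrier T₂)) (X₁#X₃ : Disjoint (carrier T₁) (carrier T₃))
    (X₂#X₃ : Disjoint (carrier T₂) (carrier T₃)) (S : Space) where

    private
      X₂ X₃ : List ℕ
      X₂ = carrier T₂
      X₃ = carrier T₃

      δ₁₂₃ : ℕ → ℕ → Carrier
      δ₁₂₃ w v = δ S (graftAt T₁ (graftAt T₂ T₃ w) v)

    coeff-associator : coeff S (associator T₁ T₂ T₃) ≈
      ∑[ w ∈ carrier T₃ ] ∑[ v ∈ carrier T₃ ] δ S (graftAt T₁ (graftAt T₂ T₃ w) v)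
    coeff-associator = begin
      coeff S (associator T₁ T₂ T₃)
        ≈⟨ coeff-⊖ S (basis T₁ ↘ (basis T₂ ↘ basis T₃)) ((basis T₁ ↘ basis T₂) ↘ basis T₃) ⟩
      coeff S (basis T₁ ↘ (basis T₂ ↘ basis T₃)) - coeff S ((basis T₁ ↘ basis T₂) ↘ basis T₃)
        ≈⟨ +-cong (coeff-basis↘[basis↘basis] T₁ T₂ T₃ S) (-‿cong (coeff-[basis↘basis]↘basis T₁ T₂ T₃ S)) ⟩
      ∑[ w ∈ X₃ ] ∑[ v ∈ X₂ ++ X₃ ] δ₁₂₃ w v
        - ∑[ v ∈ X₂ ] ∑[ w ∈ X₃ ] δ S (graftAt (graftAt T₁ T₂ v) T₃ w)
        ≈⟨ +-cong split (-‿cong regroup) ⟩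
      (∑[ w ∈ X₃ ] ∑[ v ∈ X₂ ] δ₁₂₃ w v + ∑[ w ∈ X₃ ] ∑[ v ∈ X₃ ] δ₁₂₃ w v)
        - ∑[ w ∈ X₃ ] ∑[ v ∈ X₂ ] δ₁₂₃ w v
        ≈⟨ xyx⁻¹≈y _ _ ⟩
      ∑[ w ∈ X₃ ] ∑[ v ∈ X₃ ] δ₁₂₃ w v ∎
      where
      split : ∑[ w ∈ X₃ ] ∑[ v ∈ X₂ ++ X₃ ] δ₁₂₃ w v ≈
              ∑[ w ∈ X₃ ] ∑[ v ∈ X₂ ] δ₁₂₃ w v + ∑[ w ∈ X₃ ] ∑[ v ∈ X₃ ] δ₁₂₃ w v
      split = trans (∑-cong X₃ (λ {w} _ → ∑-++ X₂ X₃ (δ₁₂₃ w))) (∑-distrib-∙ X₃ _ _)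

      regroup : ∑[ v ∈ X₂ ] ∑[ w ∈ X₃ ] δ S (graftAt (graftAt T₁ T₂ v) T₃ w) ≈
                ∑[ w ∈ X₃ ] ∑[ v ∈ X₂ ] δ₁₂₃ w v
      regroup = trans
        (∑-cong X₂ (λ v∈X₂ → ∑-cong X₃ (λ {w} _ →
          reflexive (δ-resp-≃ S (≃-sym (graftAt-assoc X₁#X₂ X₁#X₃ X₂#X₃ w v∈X₂))))))
        (∑-comm X₂ X₃ _)

mainTheorem3 : ∀ {c ℓ} (K : Field c ℓ) (T₁ T₂ T₃ : Space) →
    IsConnectedTopology T₁ → IsConnectedTopology T₂ → IsConnectedTopology T₃ →
    Disjoint (carrier T₁) (carrier T₂) → Disjoint (carrier T₁) (carrier T₃) →
    Disjoint (carrier T₂) (carrier T₃) →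
    let open Linear K in
    ((basis T₁ ↘ (basis T₂ ↘ basis T₃)) ⊖ ((basis T₁ ↘ basis T₂) ↘ basis T₃))
      ≋ ((basis T₂ ↘ (basis T₁ ↘ basis T₃)) ⊖ ((basis T₂ ↘ basis T₁) ↘ basis T₃))
mainTheorem3 K T₁ T₂ T₃ _ _ _ X₁#X₂ X₁#X₃ X₂#X₃ S = begin
  coeff S (associator T₁ T₂ T₃)
    ≈⟨ coeff-associator X₁#X₂ X₁#X₃ X₂#X₃ S ⟩
  ∑[ w ∈ X₃ ] ∑[ v ∈ X₃ ] δ S (graftAt T₁ (graftAt T₂ T₃ w) v)
    ≈⟨ ∑-cong X₃ (λ w∈X₃ → ∑-cong X₃ (λ v∈X₃ →
         reflexive (δ-resp-≃ S (graftAt-exchange X₁#X₂ X₁#X₃ X₂#X₃ v∈X₃ w∈X₃)))) ⟩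
  ∑[ w ∈ X₃ ] ∑[ v ∈ X₃ ] δ S (graftAt T₂ (graftAt T₁ T₃ v) w)
    ≈⟨ ∑-comm X₃ X₃ _ ⟩
  ∑[ v ∈ X₃ ] ∑[ w ∈ X₃ ] δ S (graftAt T₂ (graftAt T₁ T₃ v) w)
    ≈⟨ coeff-associator (Disjoint-sym X₁#X₂) X₂#X₃ X₁#X₃ S ⟨
  coeff S (associator T₂ T₁ T₃) ∎
  where
  open Field K
  open Linear K
  open ListSum +-commutativeMonoid
  open Coefficients K
  open import Relation.Binary.Reasoning.Setoid setoid
  X₃ : List ℕ
  X₃ = carrier T₃
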